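{- Let $m\ge 0$, $n\ge 1$ and let $a,b\ge 0$ be integers. The number of $\mathfrak{w}\in\mathsf{W}(m,n)$ with $\mathsf{in}(\mathfrak{w})=a$ and $\lvert\mathsf{Supp}(\mathfrak{w})\rvert=b$ equals $\displaystyle\binom{m}{b}\binom{n-a+b}{b}\binom{n-1}{n-a+b-1}$.
   Context: An $(m,n)$-word is a word $\mathfrak{w}=w_1w_2\cdots w_n$ of length $n$ over the alphabet $\{0,1,\dots,m+1\}$ such that (MN1) $w_1\neq m+1$, and (MN2) for every $s$ with $1\le s\le m$ and every index $i$, if $w_i=s$ then $w_j\ge s$ for all $j<i$. $\mathsf{W}(m,n)$ is the set of $(m,n)$-words, ordered componentwise. $\mathsf{in}(\mathfrak{w})$ is the number of elements of $\mathsf{W}(m,n)$ covered by $\mathfrak{w}$ in this order, and $\mathsf{Supp}(\mathfrak{w})$ is the set of distinct letters of $\mathfrak{w}$ lying in $\{1,\dots,m\}$. Binomial coefficients $\binom{p}{q}$ are taken to be $0$ unless $0\le q\le p$. -}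

module Defs where

open import Data.Nat using (ℕ; zero; suc; _+_; _∸_; _≤ᵇ_; _<ᵇ_; _≡ᵇ_)
open import Data.Nat.Combinatorics using (_C_)
open import Data.Integer using (ℤ; +_; -[1+_])
open import Data.Bool using (Bool; true; false; _∧_; _∨_; not; if_then_else_)
open import Data.List using (List; []; _∷_; map; filter; length; concatMap; upTo)
open import Data.Bool.ListAction using (all; any)
open import Relation.Nullary.Decidable using (Dec)
open import Data.Bool.Properties using (T?)
open import Data.Bool using (T)

allWords : ℕ → ℕ → List (List ℕ)
allWords k zero    = [] ∷ []
allWords k (suc n) = concatMap (λ x → map (x ∷_) (allWords k n)) (upTo k)

mn2 : ℕ → List ℕ → List ℕ → Bool
mn2 m prev []       = true
mn2 m prev (x ∷ xs) =
  (if (1 ≤ᵇ x) ∧ (x ≤ᵇ m) then all (λ y → x ≤ᵇ y) prev else true)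
  ∧ mn2 m (x ∷ prev) xs

mn1 : ℕ → List ℕ → Bool
mn1 m []      = true
mn1 m (x ∷ _) = not (x ≡ᵇ suc m)

isWord : ℕ → List ℕ → Bool
isWord m w = all (λ x → x ≤ᵇ suc m) w ∧ mn1 m w ∧ mn2 m [] w

W : ℕ → ℕ → List (List ℕ)
W m n = filter (λ w → T? (isWord m w)) (allWords (suc (suc m)) n)

leqW : List ℕ → List ℕ → Bool
leqW []       []       = true
leqW (x ∷ xs) (y ∷ ys) = (x ≤ᵇ y) ∧ leqW xs ys
leqW _        _        = false

eqW : List ℕ → List ℕ → Bool
eqW []       []       = true
eqW (x ∷ xs) (y ∷ ys) = (x ≡ᵇ y) ∧ eqW xs ys
eqW _        _        = false

ltW : List ℕ → List ℕ → Bool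
ltW u v = leqW u v ∧ not (eqW u v)

coveredBy : ℕ → ℕ → List ℕ → List ℕ → Bool
coveredBy m n v w = ltW v w ∧ not (any (λ u → ltW v u ∧ ltW u w) (W m n))

inW : ℕ → ℕ → List ℕ → ℕ
inW m n w = length (filter (λ v → T? (coveredBy m n v w)) (W m n))

suppSize : ℕ → List ℕ → ℕ
suppSize m w = length (filter (λ s → T? (any (λ x → x ≡ᵇ s) w)) (map suc (upTo m)))

countW : ℕ → ℕ → ℕ → ℕ → ℕ
countW m n a b =
  length (filter (λ w → T? ((inW m n w ≡ᵇ a) ∧ (suppSize m w ≡ᵇ b))) (W m n))

-- binomial coefficient with integer arguments, 0 unless 0 ≤ q ≤ p
binomℤ : ℤ → ℤ → ℕ
binomℤ (+ p)    (+ q)    = p C q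
binomℤ (+ p)    -[1+ q ] = 0
binomℤ -[1+ p ] q        = 0

-- Read an (m,n)-word from left to right keeping the level c, the minimum of the letters so
-- far other than m + 1 (initially m): (MN2) says that every letter is m + 1 or at most c.
-- A word covers exactly the words obtained by lowering one letter: an m + 1 to the level at
-- its position, or the last occurrence of a letter s ∈ {1, …, m} to s - 1. Hence
-- in(w) = t + |Supp(w)|, where t is the number of letters m + 1, and |Supp(w)| is the number
-- of times the level drops to a positive value after the first letter, plus one if that
-- letter is positive. Counting continuations at level c by length, number of letters m + 1
-- and number of drops gives a recursion on the length solved by products of binomial
-- coefficients; summing over the first letter with the hockey-stick identity yields
-- binom m b · binom (n - t) b · binom (n - 1) t for t = a - b.

module Submission where

open import Defs
open import Data.Bool using (Bool; true; false; _∧_; _∨_; not; if_then_else_; T)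
open import Data.Bool.Properties using (T?; T-≡; T-∧; T-∨; ∧-zeroʳ; ∧-identityʳ; ∨-identityʳ; if-eta)
open import Function.Bundles using (Equivalence)
open import Data.Bool.ListAction using (all; any)
open import Data.Empty using (⊥; ⊥-elim)
open import Data.List using (List; []; _∷_; _++_; map; filter; length; concatMap; upTo)
open import Data.List.Membership.Propositional using (_∈_; lose; find)
open import Data.List.Membership.Propositional.Properties
  using (∈-upTo⁺; ∈-upTo⁻; ∈-map⁺; ∈-map⁻; ∈-concatMap⁺; ∈-++⁻; ∈-++⁺ʳ; ∈-filter⁺; ∈-filter⁻)
open import Data.List.Properties
  using (≡-dec; upTo-∷ʳ; map-++; map-cong; length-++; length-map; ∷-injectiveˡ; ∷-injectiveʳ)
open import Data.List.Relation.Unary.All as All using (All; []; _∷_)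
open import Data.List.Relation.Unary.All.Properties using (map⁺; ++⁺)
open import Data.List.Relation.Unary.Any as Any using (here)
open import Data.List.Relation.Unary.Any.Properties using (any⁺; any⁻)
open import Data.List.Relation.Binary.Pointwise as Pointwise using (Pointwise; []; _∷_; Pointwise-≡⇒≡)
open import Data.List.Relation.Unary.Unique.Propositional using (Unique; []; _∷_)
import Data.List.Relation.Unary.Unique.Propositional.Properties as Unique
open import Data.Nat using (ℕ; zero; suc; pred; _+_; _*_; _∸_; _≤_; _<_; _≥_; _≤ᵇ_; _<ᵇ_; _≡ᵇ_; z≤n; s≤s)
open import Data.Nat.Combinatorics using (_C_; nCk+nC[k+1]≡[n+1]C[k+1]; nCk≡nC[n∸k])
open import Data.Nat.ListAction using (sum)
open import Data.Nat.ListAction.Properties using (sum-++)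
open import Data.Nat.Properties
open import Algebra.Properties.CommutativeSemigroup +-commutativeSemigroup using () renaming (interchange to +-interchange)
open import Data.Sum as Sum using (_⊎_; inj₁; inj₂)
open import Function using (_∘_)
open import Data.Product using (_×_; _,_; proj₁; proj₂; ∃-syntax)
open import Relation.Binary.PropositionalEquality
open import Relation.Nullary using (¬_; yes; no)
open import Data.Nat.Solver using (module +-*-Solver)
open +-*-Solver using (solve; _:+_; _:*_; _:=_; con)

T⇒≡true : ∀ {b} → T b → b ≡ true
T⇒≡true = Equivalence.to T-≡

¬T⇒≡false : ∀ {b} → ¬ T b → b ≡ false
¬T⇒≡false {true}  ¬t = ⊥-elim (¬t _)
¬T⇒≡false {false} ¬t = refl

T-not⇒¬T : ∀ {b} → T (not b) → ¬ T b
T-not⇒¬T {true} () _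

¬T⇒T-not : ∀ {b} → ¬ T b → T (not b)
¬T⇒T-not {true}  ¬t = ¬t _
¬T⇒T-not {false} ¬t = _

T-ext : ∀ {a b} → (T a → T b) → (T b → T a) → a ≡ b
T-ext {true}  {true}  _ _ = refl
T-ext {true}  {false} f _ = ⊥-elim (f _)
T-ext {false} {true}  _ g = ⊥-elim (g _)
T-ext {false} {false} _ _ = refl

≡ᵇ-true : ∀ n → (n ≡ᵇ n) ≡ true
≡ᵇ-true n = T⇒≡true (≡⇒≡ᵇ n n refl)

≡ᵇ-false : ∀ {m n} → m ≢ n → (m ≡ᵇ n) ≡ false
≡ᵇ-false {m} {n} m≢n = ¬T⇒≡false (λ t → m≢n (≡ᵇ⇒≡ m n t))

≤ᵇ-true : ∀ {m n} → m ≤ n → (m ≤ᵇ n) ≡ true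
≤ᵇ-true m≤n = T⇒≡true (≤⇒≤ᵇ m≤n)

≤ᵇ-false : ∀ {m n} → n < m → (m ≤ᵇ n) ≡ false
≤ᵇ-false {m} {n} n<m = ¬T⇒≡false (λ t → <⇒≱ n<m (≤ᵇ⇒≤ m n t))

<ᵇ-true : ∀ {m n} → m < n → (m <ᵇ n) ≡ true
<ᵇ-true m<n = T⇒≡true (<⇒<ᵇ m<n)

<ᵇ-false : ∀ {m n} → n ≤ m → (m <ᵇ n) ≡ false
<ᵇ-false {m} {n} n≤m = ¬T⇒≡false (λ t → <⇒≱ (<ᵇ⇒< m n t) n≤m)

toℕ : Bool → ℕ
toℕ true  = 1
toℕ false = 0

toℕ-not+toℕ : ∀ b k → toℕ (not b) + (k + toℕ b) ≡ suc k
toℕ-not+toℕ true  k = +-comm k 1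
toℕ-not+toℕ false k = cong suc (+-identityʳ k)

≡ᵇ-+-suc : ∀ k e a b →
           ((k + suc e ≡ᵇ a) ∧ (e ≡ᵇ b)) ≡ ((suc b ≤ᵇ a) ∧ ((k ≡ᵇ a ∸ suc b) ∧ (e ≡ᵇ b)))
≡ᵇ-+-suc k e a b with e ≟ b
... | no  e≢b rewrite ≡ᵇ-false e≢b | ∧-zeroʳ (k + suc e ≡ᵇ a) | ∧-zeroʳ (k ≡ᵇ a ∸ suc b) =
  sym (∧-zeroʳ (suc b ≤ᵇ a))
... | yes refl rewrite ≡ᵇ-true e | ∧-identityʳ (k + suc e ≡ᵇ a) | ∧-identityʳ (k ≡ᵇ a ∸ suc e)
  with k + suc e ≟ a
...   | yes refl rewrite ≡ᵇ-true (k + suc e) | ≤ᵇ-true (m≤n+m (suc e) k) | m+n∸n≡m k (suc e) | ≡ᵇ-true k = refl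
...   | no  k+e≢a rewrite ≡ᵇ-false k+e≢a with suc e ≤? a
...     | no  e≮a rewrite ≤ᵇ-false (≰⇒> e≮a) = refl
...     | yes e<a rewrite ≤ᵇ-true e<a =
  sym (≡ᵇ-false (λ k≡ → k+e≢a (trans (cong (_+ suc e) k≡) (m∸n+n≡m e<a))))

count : {A : Set} → (A → Bool) → List A → ℕ
count p []       = 0
count p (x ∷ xs) = toℕ (p x) + count p xs

module _ {A : Set} where

  length-filter : ∀ (p : A → Bool) xs → length (filter (λ x → T? (p x)) xs) ≡ count p xs
  length-filter p [] = refl
  length-filter p (x ∷ xs) with p x
  ... | true  = cong suc (length-filter p xs)
  ... | false = length-filter p xs

  count-filter : ∀ (p q : A → Bool) xs →
                 count q (filter (λ x → T? (p x)) xs) ≡ count (λ x → p x ∧ q x) xs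
  count-filter p q [] = refl
  count-filter p q (x ∷ xs) with p x
  ... | true  = cong (toℕ (q x) +_) (count-filter p q xs)
  ... | false = count-filter p q xs

  count-cong : ∀ {R : A → Set} {p q : A → Bool} {xs} →
               (∀ {x} → R x → p x ≡ q x) → All R xs → count p xs ≡ count q xs
  count-cong p≗q []         = refl
  count-cong p≗q (rx ∷ rxs) = cong₂ _+_ (cong toℕ (p≗q rx)) (count-cong p≗q rxs)

  count-ext : ∀ {p q : A → Bool} xs → (∀ x → p x ≡ q x) → count p xs ≡ count q xs
  count-ext []       p≗q = refl
  count-ext (x ∷ xs) p≗q = cong₂ _+_ (cong toℕ (p≗q x)) (count-ext xs p≗q)

  count-false : ∀ xs → count (λ (_ : A) → false) xs ≡ 0
  count-false []       = refl
  count-false (_ ∷ xs) = count-false xs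

  count-++ : ∀ (p : A → Bool) xs ys → count p (xs ++ ys) ≡ count p xs + count p ys
  count-++ p []       ys = refl
  count-++ p (x ∷ xs) ys =
    trans (cong (toℕ (p x) +_) (count-++ p xs ys)) (sym (+-assoc (toℕ (p x)) _ _))

  count-∧ˡ : ∀ b (q : A → Bool) xs → count (λ x → b ∧ q x) xs ≡ toℕ b * count q xs
  count-∧ˡ true  q xs = sym (+-identityʳ (count q xs))
  count-∧ˡ false q xs = count-false xs

  count-∨-disjoint : ∀ (p q : A → Bool) xs → (∀ x → T (p x) → T (q x) → ⊥) →
                     count (λ x → p x ∨ q x) xs ≡ count p xs + count q xs
  count-∨-disjoint p q [] _ = refl
  count-∨-disjoint p q (x ∷ xs) disj with p x in px | q x in qx
  ... | true  | true  = ⊥-elim (disj x (subst T (sym px) _) (subst T (sym qx) _))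
  ... | true  | false = cong suc (count-∨-disjoint p q xs disj)
  ... | false | true  = trans (cong suc (count-∨-disjoint p q xs disj)) (sym (+-suc (count p xs) _))
  ... | false | false = count-∨-disjoint p q xs disj

count-map : ∀ {A B : Set} (p : B → Bool) (f : A → B) xs → count p (map f xs) ≡ count (λ x → p (f x)) xs
count-map p f []       = refl
count-map p f (x ∷ xs) = cong (toℕ (p (f x)) +_) (count-map p f xs)

count-concatMap : ∀ {A B : Set} (p : B → Bool) (f : A → List B) xs →
                  count p (concatMap f xs) ≡ sum (map (λ x → count p (f x)) xs)
count-concatMap p f []       = refl
count-concatMap p f (x ∷ xs) = trans (count-++ p (f x) (concatMap f xs)) (cong (count p (f x) +_) (count-concatMap p f xs))

∑< : ℕ → (ℕ → ℕ) → ℕ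
∑< zero    f = 0
∑< (suc k) f = ∑< k f + f k

syntax ∑< k (λ i → e) = ∑[ i < k ] e

sum-map-upTo : ∀ (f : ℕ → ℕ) k → sum (map f (upTo k)) ≡ ∑< k f
sum-map-upTo f zero    = refl
sum-map-upTo f (suc k) = begin
  sum (map f (upTo (suc k)))         ≡⟨ cong (λ l → sum (map f l)) (sym (upTo-∷ʳ k)) ⟩
  sum (map f (upTo k ++ k ∷ []))     ≡⟨ cong sum (map-++ f (upTo k) (k ∷ [])) ⟩
  sum (map f (upTo k) ++ f k ∷ [])   ≡⟨ sum-++ (map f (upTo k)) (f k ∷ []) ⟩
  sum (map f (upTo k)) + (f k + 0)   ≡⟨ cong₂ _+_ (sum-map-upTo f k) (+-identityʳ (f k)) ⟩
  ∑< k f + f k                       ∎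
  where open ≡-Reasoning

∑-cong : ∀ k {f g : ℕ → ℕ} → (∀ i → i < k → f i ≡ g i) → ∑< k f ≡ ∑< k g
∑-cong zero    f≗g = refl
∑-cong (suc k) f≗g = cong₂ _+_ (∑-cong k (λ i i<k → f≗g i (m<n⇒m<1+n i<k))) (f≗g k ≤-refl)

∑-zero : ∀ k {f : ℕ → ℕ} → (∀ i → i < k → f i ≡ 0) → ∑< k f ≡ 0
∑-zero zero    f≗0 = refl
∑-zero (suc k) f≗0 = cong₂ _+_ (∑-zero k (λ i i<k → f≗0 i (m<n⇒m<1+n i<k))) (f≗0 k ≤-refl)

∑-*ʳ : ∀ k (f : ℕ → ℕ) a → ∑[ i < k ] (f i * a) ≡ ∑< k f * a
∑-*ʳ zero    f a = refl
∑-*ʳ (suc k) f a = trans (cong (_+ f k * a) (∑-*ʳ k f a)) (sym (*-distribʳ-+ a (∑< k f) (f k)))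

∑-suc : ∀ k (f : ℕ → ℕ) → ∑< (suc k) f ≡ f 0 + ∑[ i < k ] f (suc i)
∑-suc zero    f = +-comm 0 (f 0)
∑-suc (suc k) f = trans (cong (_+ f (suc k)) (∑-suc k f)) (+-assoc (f 0) _ _)

∑-truncate : ∀ K k {f : ℕ → ℕ} → k ≤ K → (∀ i → k ≤ i → i < K → f i ≡ 0) → ∑< K f ≡ ∑< k f
∑-truncate K k k≤K f≗0 with k ≟ K
... | yes refl = refl
∑-truncate (suc K) k k≤K f≗0 | no k≢K =
  trans (cong₂ _+_ (∑-truncate K k k≤K′ (λ i k≤i i<K → f≗0 i k≤i (m<n⇒m<1+n i<K))) (f≗0 K k≤K′ ≤-refl))
        (+-identityʳ _)
  where k≤K′ = ≤-pred (≤∧≢⇒< k≤K k≢K)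
∑-truncate zero k z≤n f≗0 | no k≢K = ⊥-elim (k≢K refl)

∑-indicator : ∀ k j c → j < k → ∑[ i < k ] (toℕ (i ≡ᵇ j) * c) ≡ c
∑-indicator (suc k) j c j<1+k with j ≟ k
... | yes refl = begin
  ∑[ i < j ] (toℕ (i ≡ᵇ j) * c) + toℕ (j ≡ᵇ j) * c
    ≡⟨ cong₂ _+_ (∑-zero j (λ i i<j → cong (λ b → toℕ b * c) (≡ᵇ-false (<⇒≢ i<j))))
                 (cong (λ b → toℕ b * c) (≡ᵇ-true j)) ⟩
  0 + 1 * c
    ≡⟨ *-identityˡ c ⟩
  c ∎
  where open ≡-Reasoning
... | no j≢k = trans (cong₂ _+_ (∑-indicator k j c (≤∧≢⇒< (≤-pred j<1+k) j≢k))
                                (cong (λ b → toℕ b * c) (≡ᵇ-false (≢-sym j≢k))))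
                     (+-identityʳ c)

-- Pascal's rule computes structurally, unlike _C_, which divides factorials.
binom : ℕ → ℕ → ℕ
binom n       zero    = 1
binom zero    (suc k) = 0
binom (suc n) (suc k) = binom n k + binom n (suc k)

atPred : (ℕ → ℕ) → ℕ → ℕ
atPred f zero    = 0
atPred f (suc k) = f k

atPred-scaled : ∀ {f g : ℕ → ℕ} a → (∀ k → f k ≡ a * g k) → ∀ k → atPred f k ≡ a * atPred g k
atPred-scaled a f≗ag zero    = sym (*-zeroʳ a)
atPred-scaled a f≗ag (suc k) = f≗ag k

binom-suc : ∀ n k → binom n k + atPred (binom n) k ≡ binom (suc n) k
binom-suc n zero    = refl
binom-suc n (suc k) = +-comm (binom n (suc k)) (binom n k)

binom-vanishes : ∀ {n k} → n < k → binom n k ≡ 0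
binom-vanishes {zero}  {suc k} _         = refl
binom-vanishes {suc n} {suc k} (s≤s n<k) = cong₂ _+_ (binom-vanishes n<k) (binom-vanishes (m<n⇒m<1+n n<k))

binom≡C : ∀ n k → binom n k ≡ n C k
binom≡C n       zero    = refl
binom≡C zero    (suc k) = refl
binom≡C (suc n) (suc k) = trans (cong₂ _+_ (binom≡C n k) (binom≡C n (suc k))) (nCk+nC[k+1]≡[n+1]C[k+1] n k)

hockey-stick : ∀ c d → ∑[ i < c ] binom i d ≡ binom c (suc d)
hockey-stick zero    d = refl
hockey-stick (suc c) d = trans (cong (_+ binom c d) (hockey-stick c d)) (+-comm (binom c (suc d)) (binom c d))

-- The universe of words and the componentwise order

Sized : ℕ → ℕ → List ℕ → Set
Sized k n w = length w ≡ n × All (_< k) w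

allWords-sized : ∀ k n → All (Sized k n) (allWords k n)
allWords-sized k zero    = (refl , []) ∷ []
allWords-sized k (suc n) = prepend-all (upTo k) (All.tabulate ∈-upTo⁻)
  where
  prepend-all : ∀ xs → All (_< k) xs → All (Sized k (suc n)) (concatMap (λ x → map (x ∷_) (allWords k n)) xs)
  prepend-all []       []         = []
  prepend-all (x ∷ xs) (x<k ∷ ps) =
    ++⁺ (map⁺ (All.map (λ (len , ys<k) → cong suc len , x<k ∷ ys<k) (allWords-sized k n))) (prepend-all xs ps)

∈-allWords : ∀ {k n w} → Sized k n w → w ∈ allWords k n
∈-allWords {n = zero}  {[]}     _                   = here refl
∈-allWords {k} {suc n} {x ∷ w} (len , x<k ∷ w<k) =
  ∈-concatMap⁺ (λ y → map (y ∷_) (allWords k n))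
    (Any.map (λ { refl → ∈-map⁺ (x ∷_) (∈-allWords (suc-injective len , w<k)) }) (∈-upTo⁺ x<k))

count-allWords-suc : ∀ (p : List ℕ → Bool) k n →
                     count p (allWords k (suc n)) ≡ ∑[ x < k ] count (λ ys → p (x ∷ ys)) (allWords k n)
count-allWords-suc p k n = begin
  count p (allWords k (suc n))
    ≡⟨ count-concatMap p (λ x → map (x ∷_) (allWords k n)) (upTo k) ⟩
  sum (map (λ x → count p (map (x ∷_) (allWords k n))) (upTo k))
    ≡⟨ cong sum (map-cong (λ x → count-map p (x ∷_) (allWords k n)) (upTo k)) ⟩
  sum (map (λ x → count (λ ys → p (x ∷ ys)) (allWords k n)) (upTo k))
    ≡⟨ sum-map-upTo _ k ⟩
  ∑[ x < k ] count (λ ys → p (x ∷ ys)) (allWords k n) ∎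
  where open ≡-Reasoning

eqW⇒≡ : ∀ {u v} → T (eqW u v) → u ≡ v
eqW⇒≡ {[]}    {[]}    _ = refl
eqW⇒≡ {x ∷ u} {y ∷ v} t with Equivalence.to T-∧ t
... | x≡y , u≡v = cong₂ _∷_ (≡ᵇ⇒≡ x y x≡y) (eqW⇒≡ u≡v)

eqW-refl : ∀ u → T (eqW u u)
eqW-refl []      = _
eqW-refl (x ∷ u) = Equivalence.from T-∧ (≡⇒≡ᵇ x x refl , eqW-refl u)

count-allWords-≡ : ∀ {k n w} → Sized k n w → count (λ v → eqW v w) (allWords k n) ≡ 1
count-allWords-≡ {n = zero}  {[]}    _ = refl
count-allWords-≡ {k} {suc n} {x ∷ w} (len , x<k ∷ w<k) = begin
  count (λ v → eqW v (x ∷ w)) (allWords k (suc n))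
    ≡⟨ count-allWords-suc (λ v → eqW v (x ∷ w)) k n ⟩
  ∑[ y < k ] count (λ ys → (y ≡ᵇ x) ∧ eqW ys w) (allWords k n)
    ≡⟨ ∑-cong k (λ y _ → trans (count-∧ˡ (y ≡ᵇ x) (λ ys → eqW ys w) (allWords k n))
                               (cong (toℕ (y ≡ᵇ x) *_) (count-allWords-≡ (suc-injective len , w<k)))) ⟩
  ∑[ y < k ] (toℕ (y ≡ᵇ x) * 1)
    ≡⟨ ∑-indicator k x 1 x<k ⟩
  1 ∎
  where open ≡-Reasoning

count-allWords-∈ : ∀ {k n S} → Unique S → All (Sized k n) S →
                   count (λ v → any (λ u → eqW v u) S) (allWords k n) ≡ length S
count-allWords-∈ {k} {n} [] [] = count-false (allWords k n)
count-allWords-∈ {k} {n} {s ∷ S} (s∉S ∷ uniq) (s-sized ∷ S-sized) =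
  trans (count-∨-disjoint (λ v → eqW v s) (λ v → any (λ u → eqW v u) S) (allWords k n) disjoint)
        (cong₂ _+_ (count-allWords-≡ s-sized) (count-allWords-∈ uniq S-sized))
  where
  disjoint : ∀ v → T (eqW v s) → T (any (λ u → eqW v u) S) → ⊥
  disjoint v v≡s v∈S with eqW⇒≡ {v} {s} v≡s
  ... | refl = All.lookup s∉S (Any.map eqW⇒≡ (any⁻ _ S v∈S)) refl

length-if : ∀ {A : Set} b (a : A) → length (if b then a ∷ [] else []) ≡ toℕ b
length-if true  _ = refl
length-if false _ = refl

Unique-if∷ : ∀ {A : Set} b {a : A} {xs} → (T b → All (a ≢_) xs) → Unique xs →
             Unique ((if b then a ∷ [] else []) ++ xs)
Unique-if∷ true  fresh uniq = fresh _ ∷ uniq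
Unique-if∷ false fresh uniq = uniq

infix 4 _≤*_

_≤*_ : List ℕ → List ℕ → Set
_≤*_ = Pointwise _≤_

leqW⇒≤* : ∀ {u v} → T (leqW u v) → u ≤* v
leqW⇒≤* {[]}    {[]}    _ = []
leqW⇒≤* {x ∷ u} {y ∷ v} t with Equivalence.to T-∧ t
... | x≤y , u≤v = ≤ᵇ⇒≤ x y x≤y ∷ leqW⇒≤* u≤v

≤*⇒leqW : ∀ {u v} → u ≤* v → T (leqW u v)
≤*⇒leqW []            = _
≤*⇒leqW (x≤y ∷ u≤*v) = Equivalence.from T-∧ (≤⇒≤ᵇ x≤y , ≤*⇒leqW u≤*v)

≤*-refl : ∀ u → u ≤* u
≤*-refl u = Pointwise.refl ≤-refl

≤*-antisym : ∀ {u v} → u ≤* v → v ≤* u → u ≡ v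
≤*-antisym u≤v v≤u = Pointwise-≡⇒≡ (Pointwise.antisymmetric ≤-antisym u≤v v≤u)

ltW⇒< : ∀ {u v} → T (ltW u v) → u ≤* v × u ≢ v
ltW⇒< {u} t with Equivalence.to T-∧ t
... | u≤v , u≠v = leqW⇒≤* u≤v , λ { refl → T-not⇒¬T u≠v (eqW-refl u) }

<⇒ltW : ∀ {u v} → u ≤* v → u ≢ v → T (ltW u v)
<⇒ltW u≤v u≢v = Equivalence.from T-∧ (≤*⇒leqW u≤v , ¬T⇒T-not (λ t → u≢v (eqW⇒≡ t)))

module _ (m : ℕ) where

  strings : ℕ → List (List ℕ)
  strings = allWords (suc (suc m))

  admissible : ℕ → List ℕ → Bool
  admissible c []       = true
  admissible c (y ∷ ys) = if y ≡ᵇ suc m then admissible c ys else (y ≤ᵇ c) ∧ admissible y ys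

  next : ℕ → ℕ → ℕ
  next c y = if y ≡ᵇ suc m then c else y

  word : List ℕ → Bool
  word []       = true
  word (x ∷ xs) = (x ≤ᵇ m) ∧ admissible x xs

  data Admissible (c : ℕ) : List ℕ → Set where
    []   : Admissible c []
    top∷ : ∀ {ys} → Admissible c ys → Admissible c (suc m ∷ ys)
    _∷_  : ∀ {y ys} → y ≤ c → Admissible y ys → Admissible c (y ∷ ys)

  ≤m⇒≢top : ∀ {y} → y ≤ m → y ≢ suc m
  ≤m⇒≢top y≤m refl = 1+n≰n y≤m

  ≡ᵇ-top-false : ∀ {y} → y ≤ m → (y ≡ᵇ suc m) ≡ false
  ≡ᵇ-top-false y≤m = ≡ᵇ-false (≤m⇒≢top y≤m)

  admissible⇒Admissible : ∀ {c} ys → T (admissible c ys) → Admissible c ys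
  admissible⇒Admissible []       _ = []
  admissible⇒Admissible {c} (y ∷ ys) t with y ≟ suc m
  ... | yes refl rewrite ≡ᵇ-true m = top∷ (admissible⇒Admissible ys t)
  ... | no y≢top rewrite ≡ᵇ-false y≢top with Equivalence.to T-∧ t
  ...   | y≤c , t′ = ≤ᵇ⇒≤ y c y≤c ∷ admissible⇒Admissible ys t′

  Admissible⇒admissible : ∀ {c ys} → c ≤ m → Admissible c ys → T (admissible c ys)
  Admissible⇒admissible c≤m []                         = _
  Admissible⇒admissible c≤m (top∷ a) rewrite ≡ᵇ-true m = Admissible⇒admissible c≤m a
  Admissible⇒admissible c≤m (y≤c ∷ a) rewrite ≡ᵇ-top-false (≤-trans y≤c c≤m) =
    Equivalence.from T-∧ (≤⇒≤ᵇ y≤c , Admissible⇒admissible (≤-trans y≤c c≤m) a)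

  Admissible-∷⁻ : ∀ {c x xs} → c ≤ m → Admissible c (x ∷ xs) → Admissible (next c x) xs
  Admissible-∷⁻ c≤m (top∷ a) rewrite ≡ᵇ-true m = a
  Admissible-∷⁻ c≤m (x≤c ∷ a) rewrite ≡ᵇ-top-false (≤-trans x≤c c≤m) = a

  Admissible-∷⁺ : ∀ {c x xs ys} → c ≤ m → Admissible c (x ∷ xs) → Admissible (next c x) ys →
                  Admissible c (x ∷ ys)
  Admissible-∷⁺ c≤m (top∷ _) a rewrite ≡ᵇ-true m = top∷ a
  Admissible-∷⁺ c≤m (x≤c ∷ _) a rewrite ≡ᵇ-top-false (≤-trans x≤c c≤m) = x≤c ∷ a

  Admissible-sized : ∀ {c ys} → c ≤ m → Admissible c ys → All (_< suc (suc m)) ys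
  Admissible-sized c≤m []        = []
  Admissible-sized c≤m (top∷ a)  = ≤-refl ∷ Admissible-sized c≤m a
  Admissible-sized c≤m (y≤c ∷ a) = s≤s (m≤n⇒m≤1+n (≤-trans y≤c c≤m)) ∷ Admissible-sized (≤-trans y≤c c≤m) a

  Admissible-mono : ∀ {c c′ ys} → c ≤ c′ → Admissible c ys → Admissible c′ ys
  Admissible-mono c≤c′ []        = []
  Admissible-mono c≤c′ (top∷ a)  = top∷ (Admissible-mono c≤c′ a)
  Admissible-mono c≤c′ (y≤c ∷ a) = ≤-trans y≤c c≤c′ ∷ a

  word⇒Admissible : ∀ w → T (word w) → Admissible m w
  word⇒Admissible []       _ = []
  word⇒Admissible (x ∷ xs) t with Equivalence.to T-∧ t
  ... | x≤m , a = ≤ᵇ⇒≤ x m x≤m ∷ admissible⇒Admissible xs a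

  Admissible⇒word : ∀ {u w} → Admissible m u → u ≤* w → T (word w) → T (word u)
  Admissible⇒word []        _             _ = _
  Admissible⇒word (top∷ a)  (top≤x ∷ _)   t =
    ⊥-elim (1+n≰n (≤-trans top≤x (≤ᵇ⇒≤ _ m (proj₁ (Equivalence.to T-∧ t)))))
  Admissible⇒word (y≤m ∷ a) _             _ = Equivalence.from T-∧ (≤⇒≤ᵇ y≤m , Admissible⇒admissible y≤m a)

  IsLevelOf : List ℕ → ℕ → Set
  IsLevelOf prev c = ∀ s → 1 ≤ s → s ≤ m → all (λ y → s ≤ᵇ y) prev ≡ (s ≤ᵇ c)

  IsLevelOf-0∷ : ∀ prev → IsLevelOf (0 ∷ prev) 0
  IsLevelOf-0∷ prev (suc s) _ _ = refl

  IsLevelOf-top∷ : ∀ {prev c} → IsLevelOf prev c → IsLevelOf (suc m ∷ prev) c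
  IsLevelOf-top∷ lvl s 1≤s s≤m = trans (cong (_∧ _) (≤ᵇ-true (m≤n⇒m≤1+n s≤m))) (lvl s 1≤s s≤m)

  IsLevelOf-∷ : ∀ {prev c y} → IsLevelOf prev c → y ≤ c → IsLevelOf (y ∷ prev) y
  IsLevelOf-∷ {y = y} lvl y≤c s 1≤s s≤m with s ≤? y
  ... | yes s≤y rewrite ≤ᵇ-true s≤y | lvl s 1≤s s≤m = ≤ᵇ-true (≤-trans s≤y y≤c)
  ... | no  s≰y rewrite ≤ᵇ-false (≰⇒> s≰y) = refl

  mn2≡admissible : ∀ prev c ys → c ≤ m → IsLevelOf prev c →
                   (all (λ x → x ≤ᵇ suc m) ys ∧ mn2 m prev ys) ≡ admissible c ys
  mn2≡admissible prev c []           c≤m lvl = refl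
  mn2≡admissible prev c (zero ∷ ys)  c≤m lvl = mn2≡admissible (0 ∷ prev) 0 ys z≤n (IsLevelOf-0∷ prev)
  mn2≡admissible prev c (suc y ∷ ys) c≤m lvl with suc y ≤? m
  ... | yes y≤m rewrite ≤ᵇ-true (m≤n⇒m≤1+n y≤m) | ≡ᵇ-top-false y≤m | ≤ᵇ-true y≤m
                      | lvl (suc y) (s≤s z≤n) y≤m
    with suc y ≤? c
  ...   | yes y≤c rewrite ≤ᵇ-true y≤c =
    mn2≡admissible (suc y ∷ prev) (suc y) ys y≤m (IsLevelOf-∷ {prev} lvl y≤c)
  ...   | no  y≰c rewrite ≤ᵇ-false (≰⇒> y≰c) = ∧-zeroʳ (all (λ x → x ≤ᵇ suc m) ys)
  mn2≡admissible prev c (suc y ∷ ys) c≤m lvl | no y≰m with suc y ≟ suc m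
  ... | yes refl rewrite ≤ᵇ-true (≤-refl {suc m}) | ≤ᵇ-false (≤-refl {suc m}) | ≡ᵇ-true m =
    mn2≡admissible (suc m ∷ prev) c ys c≤m (IsLevelOf-top∷ {prev} lvl)
  ... | no y≢top rewrite ≤ᵇ-false (≤∧≢⇒< (≰⇒> y≰m) (≢-sym y≢top)) | ≡ᵇ-false y≢top
                       | ≤ᵇ-false (≤-<-trans c≤m (≰⇒> y≰m)) = refl

  isWord≡word : ∀ w → isWord m w ≡ word w
  isWord≡word []       = refl
  isWord≡word (x ∷ xs) with x ≤? m
  ... | yes x≤m rewrite ≤ᵇ-true (m≤n⇒m≤1+n x≤m) | ≡ᵇ-top-false x≤m | ≤ᵇ-true x≤m
                      | if-eta ((1 ≤ᵇ x) ∧ true) {true} =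
    mn2≡admissible (x ∷ []) x xs x≤m (λ s _ _ → ∧-identityʳ (s ≤ᵇ x))
  ... | no x≰m with x ≟ suc m
  ...   | yes refl rewrite ≤ᵇ-true (≤-refl {suc m}) | ≡ᵇ-true m | ≤ᵇ-false (≤-refl {suc m}) =
    ∧-zeroʳ (all (λ y → y ≤ᵇ suc m) xs)
  ...   | no x≢top rewrite ≤ᵇ-false (≤∧≢⇒< (≰⇒> x≰m) (≢-sym x≢top)) | ≤ᵇ-false (≰⇒> x≰m) = refl

  _∈ᵇ_ : ℕ → List ℕ → Bool
  s ∈ᵇ w = any (λ x → x ≡ᵇ s) w

  ∈ᵇ-∷⁻ : ∀ {s} y ys → T (s ∈ᵇ (y ∷ ys)) → y ≡ s ⊎ T (s ∈ᵇ ys)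
  ∈ᵇ-∷⁻ {s} y ys t = Sum.map₁ (≡ᵇ⇒≡ y s) (Equivalence.to T-∨ t)

  ∈ᵇ-here : ∀ {s} y ys → y ≡ s → T (s ∈ᵇ (y ∷ ys))
  ∈ᵇ-here {s} y ys y≡s = Equivalence.from T-∨ (inj₁ (≡⇒≡ᵇ y s y≡s))

  ∈ᵇ-there : ∀ {s} y ys → T (s ∈ᵇ ys) → T (s ∈ᵇ (y ∷ ys))
  ∈ᵇ-there {s} y ys t = Equivalence.from (T-∨ {y ≡ᵇ s}) (inj₂ t)

  ∉-Admissible : ∀ {c x ys} → Admissible c ys → c < x → x ≤ m → ¬ T (x ∈ᵇ ys)
  ∉-Admissible []        c<x x≤m ()
  ∉-Admissible (top∷ {ys} a) c<x x≤m x∈ with ∈ᵇ-∷⁻ (suc m) ys x∈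
  ... | inj₁ refl = 1+n≰n x≤m
  ... | inj₂ x∈′  = ∉-Admissible a c<x x≤m x∈′
  ∉-Admissible (_∷_ {y} {ys} y≤c a) c<x x≤m x∈ with ∈ᵇ-∷⁻ y ys x∈
  ... | inj₁ refl = <⇒≱ c<x y≤c
  ... | inj₂ x∈′  = ∉-Admissible a (≤-<-trans y≤c c<x) x≤m x∈′

  Admissible-pred : ∀ {c ys} → Admissible c ys → ¬ T (c ∈ᵇ ys) → Admissible (pred c) ys
  Admissible-pred []                      _  = []
  Admissible-pred (top∷ {ys} a)           c∉ = top∷ (Admissible-pred a (c∉ ∘ ∈ᵇ-there (suc m) ys))
  Admissible-pred (_∷_ {y} {ys} y≤c a)   c∉ = <⇒≤pred (≤∧≢⇒< y≤c (c∉ ∘ ∈ᵇ-here y ys)) ∷ a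

  -- Lower covers

  lowerable : ℕ → List ℕ → Bool
  lowerable x xs = (x ≡ᵇ suc m) ∨ ((1 ≤ᵇ x) ∧ not (x ∈ᵇ xs))

  lowered : ℕ → ℕ → ℕ
  lowered c x = if x ≡ᵇ suc m then c else pred x

  lowerCovers : ℕ → List ℕ → List (List ℕ)
  lowerCovers c []       = []
  lowerCovers c (x ∷ xs) = (if lowerable x xs then (lowered c x ∷ xs) ∷ [] else [])
                           ++ map (x ∷_) (lowerCovers (next c x) xs)

  ∈-lowerCovers⁻ : ∀ {c x xs u} → u ∈ lowerCovers c (x ∷ xs) →
                   (T (lowerable x xs) × u ≡ lowered c x ∷ xs)
                   ⊎ ∃[ u′ ] (u′ ∈ lowerCovers (next c x) xs × u ≡ x ∷ u′)
  ∈-lowerCovers⁻ {c} {x} {xs} u∈ with ∈-++⁻ (if lowerable x xs then (lowered c x ∷ xs) ∷ [] else []) u∈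
  ... | inj₂ u∈tail = inj₂ (∈-map⁻ (x ∷_) u∈tail)
  ... | inj₁ u∈head with lowerable x xs
  ...   | true with u∈head
  ...     | here refl = inj₁ (_ , refl)

  ∈-lowerCovers-head : ∀ {c x xs} → T (lowerable x xs) → (lowered c x ∷ xs) ∈ lowerCovers c (x ∷ xs)
  ∈-lowerCovers-head {x = x} {xs} l with lowerable x xs
  ... | true = here refl

  ∈-lowerCovers-tail : ∀ {c x xs u} → u ∈ lowerCovers (next c x) xs → (x ∷ u) ∈ lowerCovers c (x ∷ xs)
  ∈-lowerCovers-tail {c} {x} {xs} u∈ =
    ∈-++⁺ʳ (if lowerable x xs then (lowered c x ∷ xs) ∷ [] else []) (∈-map⁺ (x ∷_) u∈)

  next-≤m : ∀ c {x} → x ≤ m → next c x ≡ x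
  next-≤m c x≤m rewrite ≡ᵇ-top-false x≤m = refl

  lowered-top : ∀ c → lowered c (suc m) ≡ c
  lowered-top c rewrite ≡ᵇ-true m = refl

  lowered-≤m : ∀ c {x} → x ≤ m → lowered c x ≡ pred x
  lowered-≤m c x≤m rewrite ≡ᵇ-top-false x≤m = refl

  lowerable-top : ∀ xs → T (lowerable (suc m) xs)
  lowerable-top xs rewrite ≡ᵇ-true m = _

  lowerable-≤m : ∀ xs {x} → x ≤ m → lowerable x xs ≡ (1 ≤ᵇ x) ∧ not (x ∈ᵇ xs)
  lowerable-≤m xs x≤m rewrite ≡ᵇ-top-false x≤m = refl

  next-≤ : ∀ {c x xs} → c ≤ m → Admissible c (x ∷ xs) → next c x ≤ m
  next-≤ c≤m (top∷ _) rewrite ≡ᵇ-true m = c≤m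
  next-≤ c≤m (x≤c ∷ _) rewrite ≡ᵇ-top-false (≤-trans x≤c c≤m) = ≤-trans x≤c c≤m

  record IsLowerCover (c : ℕ) (u w : List ℕ) : Set where
    field
      admissible-cover : Admissible c u
      below      : u ≤* w
      distinct   : u ≢ w
      nothing-between : ∀ {z} → Admissible c z → u ≤* z → z ≤* w → z ≡ u ⊎ z ≡ w

  between-∷ : ∀ {c a b xs} →
              (∀ {z₀ zs} → Admissible c (z₀ ∷ zs) → a ≤ z₀ → z₀ ≤ b → z₀ ≡ a ⊎ z₀ ≡ b) →
              ∀ {z} → Admissible c z → a ∷ xs ≤* z → z ≤* b ∷ xs → z ≡ a ∷ xs ⊎ z ≡ b ∷ xs
  between-∷ heads adm (a≤z₀ ∷ xs≤zs) (z₀≤b ∷ zs≤xs) with ≤*-antisym zs≤xs xs≤zs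
  ... | refl = Sum.map (cong (_∷ _)) (cong (_∷ _)) (heads adm a≤z₀ z₀≤b)

  lowerTop-isLowerCover : ∀ {c xs} → c ≤ m → Admissible c xs → IsLowerCover c (c ∷ xs) (suc m ∷ xs)
  lowerTop-isLowerCover {c} {xs} c≤m a = record
    { admissible-cover = ≤-refl ∷ a
    ; below           = m≤n⇒m≤1+n c≤m ∷ ≤*-refl xs
    ; distinct        = ≤m⇒≢top c≤m ∘ ∷-injectiveˡ
    ; nothing-between = between-∷ heads
    }
    where
    heads : ∀ {z₀ zs} → Admissible c (z₀ ∷ zs) → c ≤ z₀ → z₀ ≤ suc m → z₀ ≡ c ⊎ z₀ ≡ suc m
    heads (top∷ _)  _    _ = inj₂ refl
    heads (z₀≤c ∷ _) c≤z₀ _ = inj₁ (≤-antisym z₀≤c c≤z₀)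

  lowerLast-isLowerCover : ∀ {c s xs} → suc s ≤ c → Admissible (suc s) xs → ¬ T (suc s ∈ᵇ xs) →
                           IsLowerCover c (s ∷ xs) (suc s ∷ xs)
  lowerLast-isLowerCover {c} {s} {xs} s<c a s∉ = record
    { admissible-cover = ≤-trans (n≤1+n s) s<c ∷ Admissible-pred a s∉
    ; below           = n≤1+n s ∷ ≤*-refl xs
    ; distinct        = <⇒≢ (n<1+n s) ∘ ∷-injectiveˡ
    ; nothing-between = between-∷ heads
    }
    where
    heads : ∀ {z₀ zs} → Admissible c (z₀ ∷ zs) → s ≤ z₀ → z₀ ≤ suc s → z₀ ≡ s ⊎ z₀ ≡ suc s
    heads {z₀} _ s≤z₀ z₀≤1+s with z₀ ≟ suc s
    ... | yes z₀≡1+s = inj₂ z₀≡1+s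
    ... | no  z₀≢1+s = inj₁ (≤-antisym (≤-pred (≤∧≢⇒< z₀≤1+s z₀≢1+s)) s≤z₀)

  lowerHead-isLowerCover : ∀ {c x xs} → c ≤ m → Admissible c (x ∷ xs) → T (lowerable x xs) →
                           IsLowerCover c (lowered c x ∷ xs) (x ∷ xs)
  lowerHead-isLowerCover c≤m (top∷ a) _ rewrite ≡ᵇ-true m = lowerTop-isLowerCover c≤m a
  lowerHead-isLowerCover c≤m (_∷_ {suc s} s<c a) l rewrite ≡ᵇ-top-false (≤-trans s<c c≤m) =
    lowerLast-isLowerCover s<c a (T-not⇒¬T l)

  cons-isLowerCover : ∀ {c x xs u} → c ≤ m → Admissible c (x ∷ xs) → IsLowerCover (next c x) u xs →
                      IsLowerCover c (x ∷ u) (x ∷ xs)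
  cons-isLowerCover {c} {x} {xs} {u} c≤m adm cover = record
    { admissible-cover = Admissible-∷⁺ c≤m adm admissible-cover
    ; below           = ≤-refl ∷ below
    ; distinct        = distinct ∘ ∷-injectiveʳ
    ; nothing-between = between
    }
    where
    open IsLowerCover cover
    between : ∀ {z} → Admissible c z → x ∷ u ≤* z → z ≤* x ∷ xs → z ≡ x ∷ u ⊎ z ≡ x ∷ xs
    between az (x≤z₀ ∷ u≤zs) (z₀≤x ∷ zs≤xs) with ≤-antisym z₀≤x x≤z₀
    ... | refl = Sum.map (cong (x ∷_)) (cong (x ∷_)) (nothing-between (Admissible-∷⁻ c≤m az) u≤zs zs≤xs)

  lowerCovers-sound : ∀ {c w u} → c ≤ m → Admissible c w → u ∈ lowerCovers c w → IsLowerCover c u w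
  lowerCovers-sound {c} {x ∷ xs} c≤m adm u∈ with ∈-lowerCovers⁻ {c} {x} {xs} u∈
  ... | inj₁ (l , refl)         = lowerHead-isLowerCover c≤m adm l
  ... | inj₂ (u′ , u′∈ , refl) =
    cons-isLowerCover c≤m adm (lowerCovers-sound (next-≤ c≤m adm) (Admissible-∷⁻ c≤m adm) u′∈)

  lowerCovers-complete : ∀ {c w v} → c ≤ m → Admissible c w → Admissible c v → v ≤* w → v ≢ w →
                         ∃[ u ] (u ∈ lowerCovers c w × v ≤* u)

  -- the first letter where v and w differ is lowered, unless it reoccurs later in w
  lowerCovers-complete-head : ∀ {c x xs v₀ vs} → c ≤ m → Admissible c (x ∷ xs) → Admissible c (v₀ ∷ vs) →
                              v₀ < x → vs ≤* xs → ∃[ u ] (u ∈ lowerCovers c (x ∷ xs) × v₀ ∷ vs ≤* u)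
  lowerCovers-complete-head c≤m (top∷ _) (top∷ _) top<top _ = ⊥-elim (<-irrefl refl top<top)
  lowerCovers-complete-head {c} {xs = xs} c≤m (top∷ _) (v₀≤c ∷ _) _ vs≤xs =
    c ∷ xs , subst (λ l → l ∷ xs ∈ lowerCovers c (suc m ∷ xs)) (lowered-top c)
                   (∈-lowerCovers-head (lowerable-top xs))
           , v₀≤c ∷ vs≤xs
  lowerCovers-complete-head c≤m (x≤c ∷ _) (top∷ _) top<x _ =
    ⊥-elim (<⇒≱ top<x (m≤n⇒m≤1+n (≤-trans x≤c c≤m)))
  lowerCovers-complete-head {c} {suc s} {xs} c≤m (s<c ∷ a) (v₀≤c ∷ av) (s≤s v₀≤s) vs≤xs
    with T? (suc s ∈ᵇ xs)
  ... | no  s∉xs =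
    s ∷ xs , subst (λ l → l ∷ xs ∈ lowerCovers c (suc s ∷ xs)) (lowered-≤m c s≤m)
                   (∈-lowerCovers-head (subst T (sym (lowerable-≤m xs s≤m)) (¬T⇒T-not s∉xs)))
           , v₀≤s ∷ vs≤xs
    where s≤m = ≤-trans s<c c≤m
  ... | yes s∈xs =
    let (u′ , u′∈ , vs≤u′) =
          lowerCovers-complete s≤m a (Admissible-mono (m≤n⇒m≤1+n v₀≤s) av) vs≤xs vs≢xs
    in suc s ∷ u′ , ∈-lowerCovers-tail {c} (subst (λ l → u′ ∈ lowerCovers l xs) (sym (next-≤m c s≤m)) u′∈)
                  , m≤n⇒m≤1+n v₀≤s ∷ vs≤u′
    where
    s≤m = ≤-trans s<c c≤m
    vs≢xs : _ ≢ xs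
    vs≢xs refl = ∉-Admissible av (s≤s v₀≤s) s≤m s∈xs

  lowerCovers-complete         c≤m []        []        []              v≢w = ⊥-elim (v≢w refl)
  lowerCovers-complete {c} {x ∷ xs} {v₀ ∷ vs} c≤m aw av (v₀≤x ∷ vs≤xs) v≢w with v₀ ≟ x
  ... | no  v₀≢x = lowerCovers-complete-head c≤m aw av (≤∧≢⇒< v₀≤x v₀≢x) vs≤xs
  ... | yes refl =
    let (u′ , u′∈ , vs≤u′) = lowerCovers-complete (next-≤ c≤m aw) (Admissible-∷⁻ c≤m aw)
                                                  (Admissible-∷⁻ c≤m av) vs≤xs (v≢w ∘ cong (v₀ ∷_))
    in v₀ ∷ u′ , ∈-lowerCovers-tail {c} {v₀} u′∈ , ≤-refl ∷ vs≤u′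

  lowerCovers-unique : ∀ {c w} → c ≤ m → Admissible c w → Unique (lowerCovers c w)
  lowerCovers-unique {w = []}         _   _  = []
  lowerCovers-unique {c} {x ∷ xs} c≤m aw =
    Unique-if∷ (lowerable x xs) (λ l → All.tabulate (fresh l))
               (Unique.map⁺ ∷-injectiveʳ (lowerCovers-unique (next-≤ c≤m aw) (Admissible-∷⁻ c≤m aw)))
    where
    fresh : T (lowerable x xs) → ∀ {v} → v ∈ map (x ∷_) (lowerCovers (next c x) xs) → lowered c x ∷ xs ≢ v
    fresh l v∈ eq with ∈-map⁻ (x ∷_) v∈
    ... | _ , _ , refl = IsLowerCover.distinct (lowerHead-isLowerCover c≤m aw l) (cong (_∷ xs) (∷-injectiveˡ eq))

  tops : List ℕ → ℕ
  tops = count (λ y → y ≡ᵇ suc m)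

  -- the support size, counted at the last occurrence of each letter in {1, …, m}
  distinctLetters : List ℕ → ℕ
  distinctLetters []       = 0
  distinctLetters (x ∷ xs) = toℕ ((1 ≤ᵇ x) ∧ ((x ≤ᵇ m) ∧ not (x ∈ᵇ xs))) + distinctLetters xs

  toℕ-lowerable : ∀ {x} xs → x ≤ suc m →
                  toℕ (lowerable x xs) ≡ toℕ (x ≡ᵇ suc m) + toℕ ((1 ≤ᵇ x) ∧ ((x ≤ᵇ m) ∧ not (x ∈ᵇ xs)))
  toℕ-lowerable {x} xs x≤1+m with x ≟ suc m
  ... | yes refl rewrite ≡ᵇ-true m | ≤ᵇ-false (≤-refl {suc m}) = refl
  ... | no  x≢top rewrite ≡ᵇ-false x≢top | ≤ᵇ-true (≤-pred (≤∧≢⇒< x≤1+m x≢top)) = refl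

  length-lowerCovers : ∀ c {w} → All (_≤ suc m) w → length (lowerCovers c w) ≡ tops w + distinctLetters w
  length-lowerCovers c []                        = refl
  length-lowerCovers c {x ∷ xs} (x≤1+m ∷ xs≤1+m) = begin
    length ((if lowerable x xs then (lowered c x ∷ xs) ∷ [] else []) ++ map (x ∷_) (lowerCovers (next c x) xs))
      ≡⟨ length-++ (if lowerable x xs then (lowered c x ∷ xs) ∷ [] else []) ⟩
    length (if lowerable x xs then (lowered c x ∷ xs) ∷ [] else []) + length (map (x ∷_) (lowerCovers (next c x) xs))
      ≡⟨ cong₂ _+_ (trans (length-if (lowerable x xs) _) (toℕ-lowerable xs x≤1+m))
                   (trans (length-map (x ∷_) (lowerCovers (next c x) xs)) (length-lowerCovers (next c x) xs≤1+m)) ⟩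
    (top + last) + (tops xs + distinctLetters xs)
      ≡⟨ +-interchange top last (tops xs) (distinctLetters xs) ⟩
    (top + tops xs) + (last + distinctLetters xs) ∎
    where
    open ≡-Reasoning
    top  = toℕ (x ≡ᵇ suc m)
    last = toℕ ((1 ≤ᵇ x) ∧ ((x ≤ᵇ m) ∧ not (x ∈ᵇ xs)))

  ∈-W : ∀ {n u} → Sized (suc (suc m)) n u → T (word u) → u ∈ W m n
  ∈-W {u = u} sized t = ∈-filter⁺ (λ z → T? (isWord m z)) (∈-allWords sized) (subst T (sym (isWord≡word u)) t)

  W⇒word : ∀ {n u} → u ∈ W m n → T (word u)
  W⇒word {n} {u} u∈ = subst T (isWord≡word u) (proj₂ (∈-filter⁻ (λ z → T? (isWord m z)) {xs = strings n} u∈))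

  lowerCover-sized : ∀ {n u w} → Sized (suc (suc m)) n w → IsLowerCover m u w → Sized (suc (suc m)) n u
  lowerCover-sized (len , _) cover =
    trans (Pointwise.Pointwise-length below) len , Admissible-sized ≤-refl admissible-cover
    where open IsLowerCover cover

  covered⇒∈lowerCovers : ∀ {n v w} → Sized (suc (suc m)) n w → T (word w) → T (word v) →
                         T (coveredBy m n v w) → T (any (λ u → eqW v u) (lowerCovers m w))
  covered⇒∈lowerCovers {n} {v} {w} sized tw tv covered with Equivalence.to T-∧ covered
  ... | v<w , no-middle with ltW⇒< v<w
  ... | v≤w , v≢w with lowerCovers-complete ≤-refl (word⇒Admissible w tw) (word⇒Admissible v tv) v≤w v≢w
  ... | u , u∈ , v≤u with ≡-dec _≟_ v u
  ...   | yes refl = any⁺ _ (lose u∈ (eqW-refl v))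
  ...   | no  v≢u  = ⊥-elim (T-not⇒¬T no-middle (any⁺ _ (lose u∈W v<u<w)))
    where
    cover = lowerCovers-sound ≤-refl (word⇒Admissible w tw) u∈
    open IsLowerCover cover
    u∈W : u ∈ W m n
    u∈W = ∈-W (lowerCover-sized sized cover) (Admissible⇒word admissible-cover below tw)
    v<u<w : T (ltW v u ∧ ltW u w)
    v<u<w = Equivalence.from T-∧ (<⇒ltW v≤u v≢u , <⇒ltW below distinct)

  ∈lowerCovers⇒covered : ∀ {n v w} → T (word w) → T (any (λ u → eqW v u) (lowerCovers m w)) →
                         T (isWord m v ∧ coveredBy m n v w)
  ∈lowerCovers⇒covered {n} {v} {w} tw v∈ with find (any⁻ _ _ v∈)
  ... | u , u∈ , v≡u with eqW⇒≡ {v} {u} v≡u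
  ... | refl = Equivalence.from T-∧ (subst T (sym (isWord≡word v)) (Admissible⇒word admissible-cover below tw) ,
                                     Equivalence.from T-∧ (<⇒ltW below distinct , ¬T⇒T-not no-middle))
    where
    open IsLowerCover (lowerCovers-sound ≤-refl (word⇒Admissible w tw) u∈)
    no-middle : ¬ T (any (λ z → ltW v z ∧ ltW z w) (W m n))
    no-middle middle with find (any⁻ _ (W m n) middle)
    ... | z , z∈ , v<z<w with Equivalence.to T-∧ v<z<w
    ...   | v<z , z<w with ltW⇒< v<z | ltW⇒< z<w
    ...     | v≤z , v≢z | z≤w , z≢w with nothing-between (word⇒Admissible z (W⇒word {n} z∈)) v≤z z≤w
    ...       | inj₁ z≡v = v≢z (sym z≡v)
    ...       | inj₂ z≡w = z≢w z≡w

  inW≡tops+distinctLetters : ∀ n w → Sized (suc (suc m)) n w → T (word w) → inW m n w ≡ tops w + distinctLetters w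
  inW≡tops+distinctLetters n w sized tw = begin
    inW m n w
      ≡⟨ length-filter (λ v → coveredBy m n v w) (W m n) ⟩
    count (λ v → coveredBy m n v w) (W m n)
      ≡⟨ count-filter (isWord m) (λ v → coveredBy m n v w) (strings n) ⟩
    count (λ v → isWord m v ∧ coveredBy m n v w) (strings n)
      ≡⟨ count-ext (strings n) (λ v → T-ext (covered⇒∈ v) (∈lowerCovers⇒covered {n} {v} tw)) ⟩
    count (λ v → any (λ u → eqW v u) (lowerCovers m w)) (strings n)
      ≡⟨ count-allWords-∈ (lowerCovers-unique ≤-refl aw)
                          (All.tabulate (lowerCover-sized sized ∘ lowerCovers-sound ≤-refl aw)) ⟩
    length (lowerCovers m w)
      ≡⟨ length-lowerCovers m (All.map ≤-pred (Admissible-sized ≤-refl aw)) ⟩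
    tops w + distinctLetters w ∎
    where
    open ≡-Reasoning
    aw = word⇒Admissible w tw
    covered⇒∈ : ∀ v → T (isWord m v ∧ coveredBy m n v w) → T (any (λ u → eqW v u) (lowerCovers m w))
    covered⇒∈ v t with Equivalence.to (T-∧ {isWord m v}) t
    ... | tv , covered = covered⇒∈lowerCovers {n} {v} sized tw (subst T (isWord≡word v) tv) covered

  count-upTo : ∀ (p : ℕ → Bool) k → count p (upTo k) ≡ ∑[ i < k ] toℕ (p i)
  count-upTo p k = trans (count≡sum (upTo k)) (sum-map-upTo (λ i → toℕ (p i)) k)
    where
    count≡sum : ∀ xs → count p xs ≡ sum (map (λ i → toℕ (p i)) xs)
    count≡sum []       = refl
    count≡sum (x ∷ xs) = cong (toℕ (p x) +_) (count≡sum xs)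

  count-≡ᵇ-letters : ∀ x (P : ℕ → Bool) →
                     count (λ s → (x ≡ᵇ s) ∧ P s) (map suc (upTo m)) ≡ toℕ ((1 ≤ᵇ x) ∧ ((x ≤ᵇ m) ∧ P x))
  count-≡ᵇ-letters x P = trans (count-map (λ s → (x ≡ᵇ s) ∧ P s) suc (upTo m))
                               (trans (count-upTo (λ i → (x ≡ᵇ suc i) ∧ P (suc i)) m) (by-letter x))
    where
    indicator : ∀ j i → toℕ ((j ≡ᵇ i) ∧ P (suc i)) ≡ toℕ (i ≡ᵇ j) * toℕ (P (suc j))
    indicator j i with i ≟ j
    ... | yes refl rewrite ≡ᵇ-true i = sym (+-identityʳ _)
    ... | no  i≢j  rewrite ≡ᵇ-false i≢j | ≡ᵇ-false (≢-sym i≢j) = refl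
    by-letter : ∀ x → ∑[ i < m ] toℕ ((x ≡ᵇ suc i) ∧ P (suc i)) ≡ toℕ ((1 ≤ᵇ x) ∧ ((x ≤ᵇ m) ∧ P x))
    by-letter zero = ∑-zero m (λ _ _ → refl)
    by-letter (suc j) with j <? m
    ... | yes j<m rewrite <ᵇ-true j<m =
      trans (∑-cong m (λ i _ → indicator j i)) (∑-indicator m j (toℕ (P (suc j))) j<m)
    ... | no  j≮m rewrite <ᵇ-false (≮⇒≥ j≮m) =
      ∑-zero m (λ i i<m → trans (indicator j i)
                                (cong (λ b → toℕ b * toℕ (P (suc j))) (≡ᵇ-false {i} {j} (λ { refl → j≮m i<m }))))

  suppSize≡distinctLetters : ∀ w → suppSize m w ≡ distinctLetters w
  suppSize≡distinctLetters w = trans (length-filter (λ s → s ∈ᵇ w) (map suc (upTo m))) (count-∈ᵇ w)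
    where
    letters = map suc (upTo m)
    count-∈ᵇ : ∀ w → count (λ s → s ∈ᵇ w) letters ≡ distinctLetters w
    count-∈ᵇ []       = count-false letters
    count-∈ᵇ (x ∷ xs) = begin
      count (λ s → (x ≡ᵇ s) ∨ (s ∈ᵇ xs)) letters
        ≡⟨ count-ext letters (λ s → ∨-split (x ≡ᵇ s) (s ∈ᵇ xs)) ⟩
      count (λ s → (s ∈ᵇ xs) ∨ ((x ≡ᵇ s) ∧ not (s ∈ᵇ xs))) letters
        ≡⟨ count-∨-disjoint (λ s → s ∈ᵇ xs) (λ s → (x ≡ᵇ s) ∧ not (s ∈ᵇ xs)) letters
                            (λ s s∈ new → T-not⇒¬T (proj₂ (Equivalence.to (T-∧ {x ≡ᵇ s}) new)) s∈) ⟩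
      count (λ s → s ∈ᵇ xs) letters + count (λ s → (x ≡ᵇ s) ∧ not (s ∈ᵇ xs)) letters
        ≡⟨ cong₂ _+_ (count-∈ᵇ xs) (count-≡ᵇ-letters x (λ s → not (s ∈ᵇ xs))) ⟩
      distinctLetters xs + toℕ ((1 ≤ᵇ x) ∧ ((x ≤ᵇ m) ∧ not (x ∈ᵇ xs)))
        ≡⟨ +-comm (distinctLetters xs) _ ⟩
      distinctLetters (x ∷ xs) ∎
      where
      open ≡-Reasoning
      ∨-split : ∀ a b → (a ∨ b) ≡ (b ∨ (a ∧ not b))
      ∨-split true  true  = refl
      ∨-split true  false = refl
      ∨-split false b     = sym (∨-identityʳ b)

  -- Counting by the first letter

  drops : ℕ → List ℕ → ℕ
  drops c []       = 0
  drops c (y ∷ ys) = if y ≡ᵇ suc m then drops c ys else toℕ ((1 ≤ᵇ y) ∧ (y <ᵇ c)) + drops y ys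

  -- Each letter of the support is counted where the level drops to it, except possibly
  -- the current level c itself.
  distinctLetters≡drops : ∀ {c ys} → c ≤ m → Admissible c ys →
                          distinctLetters ys ≡ drops c ys + toℕ ((1 ≤ᵇ c) ∧ (c ∈ᵇ ys))
  distinctLetters≡drops-∷ : ∀ {s ys} → suc s ≤ m → Admissible (suc s) ys →
                            distinctLetters (suc s ∷ ys) ≡ suc (drops (suc s) ys)

  distinctLetters≡drops {c} c≤m [] rewrite ∧-zeroʳ (1 ≤ᵇ c) = refl
  distinctLetters≡drops {c} c≤m (top∷ {ys} a)
    rewrite ≤ᵇ-false (≤-refl {suc m}) | ≡ᵇ-true m | ≡ᵇ-false (≢-sym (≤m⇒≢top c≤m)) =
    distinctLetters≡drops c≤m a
  distinctLetters≡drops {zero}  c≤m (_∷_ {zero} _ a) = distinctLetters≡drops z≤n a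
  distinctLetters≡drops {suc c} c≤m (_∷_ {zero} {ys} _ a)
    rewrite ¬T⇒≡false (∉-Admissible a (s≤s z≤n) c≤m) = distinctLetters≡drops z≤n a
  distinctLetters≡drops {suc c} c≤m (_∷_ {suc s} {ys} (s≤s s≤c) a)
    rewrite distinctLetters≡drops-∷ (≤-trans (s≤s s≤c) c≤m) a | ≡ᵇ-top-false (≤-trans (s≤s s≤c) c≤m)
    with s ≟ c
  ... | yes refl rewrite <ᵇ-false (≤-refl {s}) | ≡ᵇ-true s = +-comm 1 _
  ... | no  s≢c  rewrite <ᵇ-true (≤∧≢⇒< s≤c s≢c) | ≡ᵇ-false s≢c
                       | ¬T⇒≡false (∉-Admissible a (s≤s (≤∧≢⇒< s≤c s≢c)) c≤m) = sym (+-identityʳ _)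

  distinctLetters≡drops-∷ {s} {ys} s<m a rewrite ≤ᵇ-true s<m | distinctLetters≡drops s<m a =
    toℕ-not+toℕ (suc s ∈ᵇ ys) (drops (suc s) ys)

  tails : ℕ → ℕ → ℕ → List ℕ → Bool
  tails c t d ys = admissible c ys ∧ ((tops ys ≡ᵇ t) ∧ (drops c ys ≡ᵇ d))

  #tails : ℕ → ℕ → ℕ → ℕ → ℕ
  #tails c len t d = count (tails c t d) (strings len)

  count-tails-top∷ : ∀ c len t d → count (λ ys → tails c t d (suc m ∷ ys)) (strings len)
                                   ≡ atPred (λ t′ → #tails c len t′ d) t
  count-tails-top∷ c len zero    d = trans (count-ext (strings len) vanish) (count-false (strings len))
    where
    vanish : ∀ ys → tails c 0 d (suc m ∷ ys) ≡ false
    vanish ys rewrite ≡ᵇ-true m = ∧-zeroʳ (admissible c ys)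
  count-tails-top∷ c len (suc t) d = count-ext (strings len) unfold
    where
    unfold : ∀ ys → tails c (suc t) d (suc m ∷ ys) ≡ tails c t d ys
    unfold ys rewrite ≡ᵇ-true m = refl

  count-tails-drop∷ : ∀ {c y} len t d → 1 ≤ y → y < c → c ≤ m →
                      count (λ ys → tails c t d (y ∷ ys)) (strings len) ≡ atPred (λ d′ → #tails y len t d′) d
  count-tails-drop∷ {c} {suc y} len t d _ y<c c≤m = count-after-drop d
    where
    y≤m = ≤-trans (<⇒≤ y<c) c≤m
    unfold : ∀ d ys → tails c t d (suc y ∷ ys)
                      ≡ admissible (suc y) ys ∧ ((tops ys ≡ᵇ t) ∧ (suc (drops (suc y) ys) ≡ᵇ d))
    unfold d ys rewrite ≡ᵇ-top-false y≤m | ≤ᵇ-true (<⇒≤ y<c) | <ᵇ-true y<c = refl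
    count-after-drop : ∀ d → count (λ ys → tails c t d (suc y ∷ ys)) (strings len)
                             ≡ atPred (λ d′ → #tails (suc y) len t d′) d
    count-after-drop zero    =
      trans (count-ext (strings len) (λ ys → trans (unfold 0 ys) (no-drop ys))) (count-false (strings len))
      where
      no-drop : ∀ ys → admissible (suc y) ys ∧ ((tops ys ≡ᵇ t) ∧ false) ≡ false
      no-drop ys rewrite ∧-zeroʳ (tops ys ≡ᵇ t) = ∧-zeroʳ (admissible (suc y) ys)
    count-after-drop (suc d) = count-ext (strings len) (unfold (suc d))

  tails-stay∷ : ∀ {c} t d ys → c ≤ m → tails c t d (c ∷ ys) ≡ tails c t d ys
  tails-stay∷ {c} t d ys c≤m
    rewrite ≡ᵇ-top-false c≤m | ≤ᵇ-true (≤-refl {c}) | <ᵇ-false (≤-refl {c}) | ∧-zeroʳ (1 ≤ᵇ c) = refl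

  tails-rise∷ : ∀ {c y} t d ys → c < y → y ≤ m → tails c t d (y ∷ ys) ≡ false
  tails-rise∷ t d ys c<y y≤m rewrite ≡ᵇ-top-false y≤m | ≤ᵇ-false c<y = refl

  #tails-suc : ∀ c len t d →
               #tails c (suc len) t d ≡ #tails 0 len t d
                 + (∑[ i < m ] count (λ ys → tails c t d (suc i ∷ ys)) (strings len)
                    + atPred (λ t′ → #tails c len t′ d) t)
  #tails-suc c len t d =
    trans (count-allWords-suc (tails c t d) (suc (suc m)) len)
          (trans (∑-suc (suc m) (λ y → count (λ ys → tails c t d (y ∷ ys)) (strings len)))
                 (cong (λ x → #tails 0 len t d + (∑[ i < m ] count (λ ys → tails c t d (suc i ∷ ys)) (strings len) + x))
                       (count-tails-top∷ c len t d)))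

  #tails-level0 : ∀ len t d → #tails 0 len t d ≡ toℕ (d ≡ᵇ 0) * binom len t
  #tails-level0 zero    zero    zero    = refl
  #tails-level0 zero    zero    (suc d) = refl
  #tails-level0 zero    (suc t) zero    = refl
  #tails-level0 zero    (suc t) (suc d) = refl
  #tails-level0 (suc len) t d = begin
    #tails 0 (suc len) t d
      ≡⟨ #tails-suc 0 len t d ⟩
    #tails 0 len t d + (∑[ i < m ] count (λ ys → tails 0 t d (suc i ∷ ys)) (strings len)
                        + atPred (λ t′ → #tails 0 len t′ d) t)
      ≡⟨ cong (λ x → #tails 0 len t d + (x + atPred (λ t′ → #tails 0 len t′ d) t)) (∑-zero m rises) ⟩
    #tails 0 len t d + atPred (λ t′ → #tails 0 len t′ d) t
      ≡⟨ cong₂ _+_ (#tails-level0 len t d) (atPred-scaled (toℕ (d ≡ᵇ 0)) (λ t′ → #tails-level0 len t′ d) t) ⟩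
    toℕ (d ≡ᵇ 0) * binom len t + toℕ (d ≡ᵇ 0) * atPred (binom len) t
      ≡⟨ sym (*-distribˡ-+ (toℕ (d ≡ᵇ 0)) (binom len t) _) ⟩
    toℕ (d ≡ᵇ 0) * (binom len t + atPred (binom len) t)
      ≡⟨ cong (toℕ (d ≡ᵇ 0) *_) (binom-suc len t) ⟩
    toℕ (d ≡ᵇ 0) * binom (suc len) t ∎
    where
    open ≡-Reasoning
    rises : ∀ i → i < m → count (λ ys → tails 0 t d (suc i ∷ ys)) (strings len) ≡ 0
    rises i i<m = trans (count-ext (strings len) (λ ys → tails-rise∷ t d ys (s≤s z≤n) i<m)) (count-false (strings len))

  -- At level c + 1 there are binom c d * tailFactor len t d tails: choose the positions of the
  -- t letters m + 1, the d values in {1, …, c} the level drops to, and the lengths of the d + 2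
  -- runs (at c + 1, at each dropped value, at 0; the middle ones nonempty) of the other letters.
  tailFactor : ℕ → ℕ → ℕ → ℕ
  tailFactor len t d = binom len t * binom (suc (len ∸ t)) (suc d)

  tailFactor-suc : ∀ len t d → binom len t * binom (suc (len ∸ t)) d + tailFactor len t d
                               + atPred (λ t′ → tailFactor len t′ d) t ≡ tailFactor (suc len) t d
  tailFactor-suc len zero d =
    solve 2 (λ x y → con 1 :* x :+ con 1 :* y :+ con 0 := con 1 :* (x :+ y)) refl
            (binom (suc len) d) (binom (suc len) (suc d))
  tailFactor-suc len (suc t) d with t <? len
  ... | yes t<len rewrite +-∸-assoc 1 t<len =
    solve 4 (λ X a b Y → X :* a :+ X :* b :+ Y :* (a :+ b) := (Y :+ X) :* (a :+ b)) refl
            (binom len (suc t)) (binom (suc (len ∸ suc t)) d) (binom (suc (len ∸ suc t)) (suc d)) (binom len t)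
  ... | no  t≮len rewrite binom-vanishes (s≤s (≮⇒≥ t≮len)) =
    cong (_* binom (suc (len ∸ t)) (suc d)) (sym (+-identityʳ (binom len t)))

  ∑-first-letters : ∀ c len t d → suc c ≤ m →
                    ∑[ i < m ] count (λ ys → tails (suc c) t d (suc i ∷ ys)) (strings len)
                    ≡ ∑[ i < c ] atPred (λ d′ → #tails (suc i) len t d′) d + #tails (suc c) len t d
  ∑-first-letters c len t d c<m =
    trans (∑-truncate m (suc c) c<m rises)
          (cong₂ _+_ (∑-cong c (λ i i<c → count-tails-drop∷ len t d (s≤s z≤n) (s≤s i<c) c<m))
                     (count-ext (strings len) (λ ys → tails-stay∷ t d ys c<m)))
    where
    rises : ∀ i → suc c ≤ i → i < m → count (λ ys → tails (suc c) t d (suc i ∷ ys)) (strings len) ≡ 0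
    rises i c<i i<m = trans (count-ext (strings len) (λ ys → tails-rise∷ t d ys (s≤s c<i) i<m)) (count-false (strings len))

  lower-levels : ∀ len c t d →
                 (∀ i d′ → i < c → #tails (suc i) len t d′ ≡ binom i d′ * tailFactor len t d′) →
                 #tails 0 len t d + ∑[ i < c ] atPred (λ d′ → #tails (suc i) len t d′) d
                 ≡ binom c d * (binom len t * binom (suc (len ∸ t)) d)
  lower-levels len c t zero    _  = trans (cong₂ _+_ (#tails-level0 len t 0) (∑-zero c (λ _ _ → refl)))
                                          (trans (+-identityʳ _) (cong (1 *_) (sym (*-identityʳ (binom len t)))))
  lower-levels len c t (suc d) ih = begin
    #tails 0 len t (suc d) + ∑[ i < c ] #tails (suc i) len t d
      ≡⟨ cong₂ _+_ (#tails-level0 len t (suc d)) (∑-cong c (λ i i<c → ih i d i<c)) ⟩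
    ∑[ i < c ] (binom i d * tailFactor len t d)
      ≡⟨ ∑-*ʳ c (λ i → binom i d) (tailFactor len t d) ⟩
    ∑[ i < c ] binom i d * tailFactor len t d
      ≡⟨ cong (_* tailFactor len t d) (hockey-stick c d) ⟩
    binom c (suc d) * tailFactor len t d ∎
    where open ≡-Reasoning

  #tails-level-suc : ∀ len c t d → suc c ≤ m → #tails (suc c) len t d ≡ binom c d * tailFactor len t d
  #tails-level-suc zero c zero    zero    _ = refl
  #tails-level-suc zero c zero    (suc d) _ = sym (*-zeroʳ (binom c (suc d)))
  #tails-level-suc zero c (suc t) d       _ = sym (*-zeroʳ (binom c d))
  #tails-level-suc (suc len) c t d c<m = begin
    #tails (suc c) (suc len) t d
      ≡⟨ #tails-suc (suc c) len t d ⟩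
    #tails 0 len t d + (∑[ i < m ] count (λ ys → tails (suc c) t d (suc i ∷ ys)) (strings len) + atPred (λ t′ → #tails (suc c) len t′ d) t)
      ≡⟨ cong (λ x → #tails 0 len t d + (x + atPred (λ t′ → #tails (suc c) len t′ d) t)) (∑-first-letters c len t d c<m) ⟩
    #tails 0 len t d + (lower + #tails (suc c) len t d + atPred (λ t′ → #tails (suc c) len t′ d) t)
      ≡⟨ solve 4 (λ a b x y → a :+ (b :+ x :+ y) := a :+ b :+ x :+ y) refl (#tails 0 len t d) lower _ _ ⟩
    #tails 0 len t d + lower + #tails (suc c) len t d + atPred (λ t′ → #tails (suc c) len t′ d) t
      ≡⟨ cong₂ _+_ (cong₂ _+_ (lower-levels len c t d (λ i d′ i<c → #tails-level-suc len i t d′ (≤-trans i<c (<⇒≤ c<m))))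
                              (#tails-level-suc len c t d c<m))
                   (atPred-scaled (binom c d) (λ t′ → #tails-level-suc len c t′ d c<m) t) ⟩
    B * R + B * tailFactor len t d + B * atPred (λ t′ → tailFactor len t′ d) t
      ≡⟨ solve 4 (λ b x y z → b :* x :+ b :* y :+ b :* z := b :* (x :+ y :+ z)) refl B R (tailFactor len t d) _ ⟩
    B * (R + tailFactor len t d + atPred (λ t′ → tailFactor len t′ d) t)
      ≡⟨ cong (B *_) (tailFactor-suc len t d) ⟩
    B * tailFactor (suc len) t d ∎
    where
    open ≡-Reasoning
    lower = ∑[ i < c ] atPred (λ d′ → #tails (suc i) len t d′) d
    B = binom c d
    R = binom len t * binom (suc (len ∸ t)) d

  counted : ℕ → ℕ → List ℕ → Bool
  counted a b w = word w ∧ ((tops w + distinctLetters w ≡ᵇ a) ∧ (distinctLetters w ≡ᵇ b))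

  countW≡count-counted : ∀ n a b → countW m n a b ≡ count (counted a b) (strings n)
  countW≡count-counted n a b =
    trans (length-filter _ (W m n))
          (trans (count-filter (isWord m) _ (strings n)) (count-cong same (allWords-sized (suc (suc m)) n)))
    where
    same : ∀ {w} → Sized (suc (suc m)) n w →
           (isWord m w ∧ ((inW m n w ≡ᵇ a) ∧ (suppSize m w ≡ᵇ b))) ≡ counted a b w
    same {w} sized rewrite isWord≡word w with word w in tw
    ... | false = refl
    ... | true rewrite inW≡tops+distinctLetters n w sized (subst T (sym tw) _) | suppSize≡distinctLetters w = refl

  drops-level0 : ∀ {ys} → Admissible 0 ys → drops 0 ys ≡ 0
  drops-level0 []                  = refl
  drops-level0 (top∷ a) rewrite ≡ᵇ-true m = drops-level0 a
  drops-level0 (_∷_ {zero} z≤n a)  = drops-level0 a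

  counted-0∷ : ∀ a b ys → counted a b (0 ∷ ys) ≡ tails 0 a b ys
  counted-0∷ a b ys with admissible 0 ys in adm
  ... | false = refl
  ... | true rewrite distinctLetters≡drops z≤n (admissible⇒Admissible ys (subst T (sym adm) _))
                   | drops-level0 (admissible⇒Admissible ys (subst T (sym adm) _)) | +-identityʳ (tops ys) = refl

  counted-letter∷ : ∀ {x} a b ys → 1 ≤ x → x ≤ m →
                    counted a (suc b) (x ∷ ys) ≡ (suc b ≤ᵇ a) ∧ tails x (a ∸ suc b) b ys
  counted-letter∷ {suc s} a b ys _ x≤m with admissible (suc s) ys in adm
  ... | false rewrite ≤ᵇ-true x≤m = sym (∧-zeroʳ (suc b ≤ᵇ a))
  ... | true rewrite distinctLetters≡drops-∷ x≤m (admissible⇒Admissible ys (subst T (sym adm) _))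
                   | ≤ᵇ-true x≤m | ≡ᵇ-top-false x≤m =
    ≡ᵇ-+-suc (tops ys) (drops (suc s) ys) a b

  counted-letter∷-0 : ∀ {x} a ys → 1 ≤ x → x ≤ m → counted a 0 (x ∷ ys) ≡ false
  counted-letter∷-0 {suc s} a ys _ x≤m with admissible (suc s) ys in adm
  ... | false rewrite ≤ᵇ-true x≤m = refl
  ... | true rewrite distinctLetters≡drops-∷ x≤m (admissible⇒Admissible ys (subst T (sym adm) _)) | ≤ᵇ-true x≤m =
    ∧-zeroʳ (tops (suc s ∷ ys) + suc (drops (suc s) ys) ≡ᵇ a)

  counted-top∷ : ∀ a b ys → counted a b (suc m ∷ ys) ≡ false
  counted-top∷ a b ys rewrite ≤ᵇ-false (≤-refl {suc m}) = refl

  closedForm : ℕ → ℕ → ℕ → ℕ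
  closedForm n′ a zero    = binom n′ a
  closedForm n′ a (suc b) = toℕ (suc b ≤ᵇ a) * (binom m (suc b) * tailFactor n′ (a ∸ suc b) b)

  count-counted-by-first : ∀ n′ a b → count (counted a b) (strings (suc n′))
                           ≡ #tails 0 n′ a b + ∑[ i < m ] count (λ ys → counted a b (suc i ∷ ys)) (strings n′)
  count-counted-by-first n′ a b = begin
    count (counted a b) (strings (suc n′))
      ≡⟨ count-allWords-suc (counted a b) (suc (suc m)) n′ ⟩
    ∑[ x < suc (suc m) ] first x
      ≡⟨ ∑-suc (suc m) first ⟩
    first 0 + (∑[ i < m ] first (suc i) + first (suc m))
      ≡⟨ cong₂ _+_ (count-ext (strings n′) (counted-0∷ a b)) (cong (∑[ i < m ] first (suc i) +_) no-top-start) ⟩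
    #tails 0 n′ a b + (∑[ i < m ] first (suc i) + 0)
      ≡⟨ cong (#tails 0 n′ a b +_) (+-identityʳ _) ⟩
    #tails 0 n′ a b + ∑[ i < m ] first (suc i) ∎
    where
    open ≡-Reasoning
    first : ℕ → ℕ
    first x = count (λ ys → counted a b (x ∷ ys)) (strings n′)
    no-top-start : first (suc m) ≡ 0
    no-top-start = trans (count-ext (strings n′) (counted-top∷ a b)) (count-false (strings n′))

  count-counted-letter∷ : ∀ n′ a b i → i < m → count (λ ys → counted a (suc b) (suc i ∷ ys)) (strings n′)
                          ≡ binom i b * (toℕ (suc b ≤ᵇ a) * tailFactor n′ (a ∸ suc b) b)
  count-counted-letter∷ n′ a b i i<m = begin
    count (λ ys → counted a (suc b) (suc i ∷ ys)) (strings n′)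
      ≡⟨ count-ext (strings n′) (λ ys → counted-letter∷ a b ys (s≤s z≤n) i<m) ⟩
    count (λ ys → (suc b ≤ᵇ a) ∧ tails (suc i) (a ∸ suc b) b ys) (strings n′)
      ≡⟨ count-∧ˡ (suc b ≤ᵇ a) (tails (suc i) (a ∸ suc b) b) (strings n′) ⟩
    toℕ (suc b ≤ᵇ a) * #tails (suc i) n′ (a ∸ suc b) b
      ≡⟨ cong (toℕ (suc b ≤ᵇ a) *_) (#tails-level-suc n′ i (a ∸ suc b) b i<m) ⟩
    toℕ (suc b ≤ᵇ a) * (binom i b * tailFactor n′ (a ∸ suc b) b)
      ≡⟨ solve 3 (λ x y z → x :* (y :* z) := y :* (x :* z)) refl
                 (toℕ (suc b ≤ᵇ a)) (binom i b) (tailFactor n′ (a ∸ suc b) b) ⟩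
    binom i b * (toℕ (suc b ≤ᵇ a) * tailFactor n′ (a ∸ suc b) b) ∎
    where open ≡-Reasoning

  count-counted : ∀ n′ a b → count (counted a b) (strings (suc n′)) ≡ closedForm n′ a b
  count-counted n′ a zero = begin
    count (counted a 0) (strings (suc n′))
      ≡⟨ count-counted-by-first n′ a 0 ⟩
    #tails 0 n′ a 0 + ∑[ i < m ] count (λ ys → counted a 0 (suc i ∷ ys)) (strings n′)
      ≡⟨ cong₂ _+_ (#tails-level0 n′ a 0) (∑-zero m nothing) ⟩
    binom n′ a + 0 + 0
      ≡⟨ trans (+-identityʳ _) (+-identityʳ _) ⟩
    binom n′ a ∎
    where
    open ≡-Reasoning
    nothing : ∀ i → i < m → count (λ ys → counted a 0 (suc i ∷ ys)) (strings n′) ≡ 0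
    nothing i i<m =
      trans (count-ext (strings n′) (λ ys → counted-letter∷-0 a ys (s≤s z≤n) i<m)) (count-false (strings n′))
  count-counted n′ a (suc b) = begin
    count (counted a (suc b)) (strings (suc n′))
      ≡⟨ count-counted-by-first n′ a (suc b) ⟩
    #tails 0 n′ a (suc b) + ∑[ i < m ] count (λ ys → counted a (suc b) (suc i ∷ ys)) (strings n′)
      ≡⟨ cong₂ _+_ (#tails-level0 n′ a (suc b)) (∑-cong m (count-counted-letter∷ n′ a b)) ⟩
    ∑[ i < m ] (binom i b * (bounded * tailFactor n′ (a ∸ suc b) b))
      ≡⟨ ∑-*ʳ m (λ i → binom i b) _ ⟩
    ∑[ i < m ] binom i b * (bounded * tailFactor n′ (a ∸ suc b) b)
      ≡⟨ cong (_* (bounded * tailFactor n′ (a ∸ suc b) b)) (hockey-stick m b) ⟩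
    binom m (suc b) * (bounded * tailFactor n′ (a ∸ suc b) b)
      ≡⟨ solve 3 (λ x y z → x :* (y :* z) := y :* (x :* z)) refl
                 (binom m (suc b)) bounded (tailFactor n′ (a ∸ suc b) b) ⟩
    closedForm n′ a (suc b) ∎
    where
    open ≡-Reasoning
    bounded = toℕ (suc b ≤ᵇ a)

  closedForm-vanishes : ∀ n′ a b → n′ < a ∸ b → closedForm n′ a b ≡ 0
  closedForm-vanishes n′ a zero    n′<a = binom-vanishes n′<a
  closedForm-vanishes n′ a (suc b) n′<t rewrite binom-vanishes n′<t | *-zeroʳ (binom m (suc b)) =
    *-zeroʳ (toℕ (suc b ≤ᵇ a))

  closedForm-positive : ∀ n′ a b k → suc k + a ≡ suc n′ + b →
                        closedForm n′ a b ≡ (m C b) * (suc k C b) * (n′ C k)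
  closedForm-positive n′ a zero k k+a≡n′ = begin
    binom n′ a           ≡⟨ binom≡C n′ a ⟩
    n′ C a               ≡⟨ nCk≡nC[n∸k] (subst (a ≤_) k+a≡n′′ (m≤n+m a k)) ⟩
    n′ C (n′ ∸ a)        ≡⟨ cong (n′ C_) (trans (cong (_∸ a) (sym k+a≡n′′)) (m+n∸n≡m k a)) ⟩
    n′ C k               ≡⟨ sym (+-identityʳ (n′ C k)) ⟩
    1 * 1 * (n′ C k)     ∎
    where
    open ≡-Reasoning
    k+a≡n′′ : k + a ≡ n′
    k+a≡n′′ = suc-injective (trans k+a≡n′ (+-identityʳ (suc n′)))
  closedForm-positive n′ a (suc b) k k+a≡n′+b with suc b ≤? a
  ... | no  b≮a rewrite ≤ᵇ-false (≰⇒> b≮a) =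
    sym (trans (cong ((m C suc b) * (suc k C suc b) *_) (trans (sym (binom≡C n′ k)) (binom-vanishes n′<k)))
               (*-zeroʳ ((m C suc b) * (suc k C suc b))))
    where
    n′<k : n′ < k
    n′<k = +-cancelʳ-< a n′ k (≤-trans (+-monoʳ-≤ (suc n′) (≤-pred (≰⇒> b≮a)))
                                       (≤-reflexive (suc-injective (trans (sym (+-suc (suc n′) b)) (sym k+a≡n′+b)))))
  ... | yes b<a rewrite ≤ᵇ-true b<a = begin
    1 * (binom m (suc b) * (binom n′ t * binom (suc (n′ ∸ t)) (suc b)))
      ≡⟨ cong (λ x → 1 * (binom m (suc b) * (binom n′ t * binom (suc x) (suc b)))) n′∸t≡k ⟩
    1 * (binom m (suc b) * (binom n′ t * binom (suc k) (suc b)))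
      ≡⟨ cong₂ (λ x y → 1 * (x * (y * binom (suc k) (suc b)))) (binom≡C m (suc b))
                (trans (binom≡C n′ t) (trans (nCk≡nC[n∸k] t≤n′) (cong (n′ C_) n′∸t≡k))) ⟩
    1 * ((m C suc b) * ((n′ C k) * binom (suc k) (suc b)))
      ≡⟨ cong (λ x → 1 * ((m C suc b) * ((n′ C k) * x))) (binom≡C (suc k) (suc b)) ⟩
    1 * ((m C suc b) * ((n′ C k) * (suc k C suc b)))
      ≡⟨ solve 3 (λ x y z → con 1 :* (x :* (y :* z)) := x :* z :* y) refl (m C suc b) (n′ C k) (suc k C suc b) ⟩
    (m C suc b) * (suc k C suc b) * (n′ C k) ∎
    where
    open ≡-Reasoning
    t = a ∸ suc b
    k+t≡n′ : k + t ≡ n′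
    k+t≡n′ = suc-injective (+-cancelʳ-≡ (suc b) (suc k + t) (suc n′)
               (trans (+-assoc (suc k) t (suc b)) (trans (cong (suc k +_) (m∸n+n≡m b<a)) k+a≡n′+b)))
    t≤n′ : t ≤ n′
    t≤n′ = subst (t ≤_) k+t≡n′ (m≤n+m t k)
    n′∸t≡k : n′ ∸ t ≡ k
    n′∸t≡k = trans (cong (_∸ t) (sym k+t≡n′)) (m+n∸n≡m k t)

-- imported only here: with +_ in scope, sections such as (x +_) above would be ambiguous
open import Data.Integer as ℤ using (+_; _⊖_)
open import Data.Integer.Properties using ([+m]-[+n]≡m⊖n; distribˡ-⊖-+-pos; ⊖-≥; ⊖-<)

[n-a]+b≡[n+b]⊖a : ∀ n a b → (+ n ℤ.- + a) ℤ.+ + b ≡ (n + b) ⊖ a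
[n-a]+b≡[n+b]⊖a n a b = trans (cong (λ z → z ℤ.+ + b) ([+m]-[+n]≡m⊖n n a)) (distribˡ-⊖-+-pos b n a)

closedForm≡binomℤ : ∀ m n′ a b → closedForm m n′ a b
                    ≡ (m C b) * binomℤ ((suc n′ + b) ⊖ a) (+ b) * binomℤ (+ n′) (((suc n′ + b) ⊖ a) ℤ.- + 1)
closedForm≡binomℤ m n′ a b with a ≤? suc n′ + b
... | yes a≤ rewrite ⊖-≥ a≤ = by-shift (suc n′ + b ∸ a) (m∸n+n≡m a≤)
  where
  by-shift : ∀ k → k + a ≡ suc n′ + b →
             closedForm m n′ a b ≡ (m C b) * binomℤ (+ k) (+ b) * binomℤ (+ n′) (+ k ℤ.- + 1)
  by-shift zero    a≡ =
    trans (closedForm-vanishes m n′ a b (≤-reflexive (sym (trans (cong (_∸ b) a≡) (m+n∸n≡m (suc n′) b)))))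
          (sym (*-zeroʳ ((m C b) * (0 C b))))
  by-shift (suc k) k+a≡ = closedForm-positive m n′ a b k k+a≡
... | no  a≰ rewrite ⊖-< (≰⇒> a≰) with a ∸ (suc n′ + b) | m>n⇒m∸n≢0 (≰⇒> a≰)
...   | zero  | nonzero = ⊥-elim (nonzero refl)
...   | suc j | _       = trans (closedForm-vanishes m n′ a b (m+n≤o⇒m≤o∸n (suc n′) (<⇒≤ (≰⇒> a≰))))
                                (cong (_* binomℤ (+ n′) (ℤ.-[1+ j ] ℤ.- + 1)) (sym (*-zeroʳ (m C b))))

corollary5p4 : (m n a b : ℕ) → n ≥ 1 →
    countW m n a b ≡
      (m C b) * binomℤ ((+ n ℤ.- + a) ℤ.+ + b) (+ b)
        * binomℤ (+ n ℤ.- + 1) (((+ n ℤ.- + a) ℤ.+ + b) ℤ.- + 1)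
corollary5p4 m (suc n′) a b _ rewrite [n-a]+b≡[n+b]⊖a (suc n′) a b = begin
  countW m (suc n′) a b                      ≡⟨ countW≡count-counted m (suc n′) a b ⟩
  count (counted m a b) (strings m (suc n′)) ≡⟨ count-counted m n′ a b ⟩
  closedForm m n′ a b                        ≡⟨ closedForm≡binomℤ m n′ a b ⟩
  _                                          ∎
  where open ≡-Reasoning
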